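{- Let $A=\{A_1,\dots,A_m\}$ be a non-disjoint $(n_a,m,k_a,\lambda_a)$-PSEDF in a group $G_a$ and $B=\{B_1,\dots,B_m\}$ a non-disjoint $(n_b,m,k_b,\lambda_b)$-PSEDF in a group $G_b$. Then $L=\{A_i\times B_i:1\le i\le m\}$ is a non-disjoint $(n_an_b,m,k_ak_b,\lambda_a\lambda_b)$-PSEDF in $G_a\times G_b$.
   Context: For subsets $A,B$ of an additively written group $G$, $\Delta(A,B)$ denotes the multiset $\{a-b:a\in A,b\in B\}$ (one entry per pair). For $\lambda\in\mathbb{N}$, $\lambda G$ is the multiset containing every element of $G$ exactly $\lambda$ times. For a group $G$ of order $v$ and $m>1$, a family of $k$-subsets $\{A_1,\dots,A_m\}$ of $G$ is a non-disjoint $(v,m,k,\lambda)$-PSEDF if $\Delta(A_i,A_j)=\lambda G$ for all $1\le i\ne j\le m$. -}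

module Defs where

open import Level using (Level; _⊔_)
open import Data.Nat using (ℕ; zero; suc; _+_; _*_; _<_)
open import Data.Fin using (Fin; zero; suc; remQuot)
open import Data.Product using (Σ; ∃; _×_; _,_; proj₁; proj₂)
open import Data.Bool using (if_then_else_)
open import Relation.Nullary using (Dec; yes; no; ¬_; does)
open import Relation.Binary using (Decidable)
open import Relation.Binary.PropositionalEquality using (_≡_; _≢_)
open import Algebra.Bundles using (Group)
import Algebra.Construct.DirectProduct as DP

private variable c ℓ c₁ ℓ₁ c₂ ℓ₂ : Level

sumFin : ∀ {n} → (Fin n → ℕ) → ℕ
sumFin {zero}  f = 0
sumFin {suc n} f = f zero + sumFin (λ i → f (suc i))

module _ (G : Group c ℓ) where
  open Group G

  HasOrder : ℕ → Set (c ⊔ ℓ)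
  HasOrder v = Σ (Fin v → Carrier) λ f →
    (∀ i j → f i ≈ f j → i ≡ j) × (∀ g → ∃ λ i → f i ≈ g)

  -- a k-subset of G, given by an injective enumeration Fin k → Carrier (the subset is its image)
  IsKSubset : ∀ {k} → (Fin k → Carrier) → Set ℓ
  IsKSubset {k} A = ∀ i j → A i ≈ A j → i ≡ j

  -- multiplicity of g in the multiset Δ(A,B) = {a - b : a ∈ A, b ∈ B}, where a - b = a ∙ b⁻¹
  multΔ : (Decidable _≈_) → ∀ {k l} → (Fin k → Carrier) → (Fin l → Carrier) → Carrier → ℕ
  multΔ _≟_ A B g =
    sumFin λ x → sumFin λ y → if does ((A x ∙ (B y) ⁻¹) ≟ g) then 1 else 0

  IsPSEDF : Decidable _≈_ → (v m k λ' : ℕ) → (Fin m → Fin k → Carrier) → Set (c ⊔ ℓ)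
  IsPSEDF _≟_ v m k λ' A =
    HasOrder v × (1 < m) × (∀ i → IsKSubset (A i)) ×
    (∀ i j → i ≢ j → ∀ g → multΔ _≟_ (A i) (A j) g ≡ λ')

_×G_ : Group c₁ ℓ₁ → Group c₂ ℓ₂ → Group (c₁ ⊔ c₂) (ℓ₁ ⊔ ℓ₂)
G ×G H = DP.group G H

×-dec : (G : Group c₁ ℓ₁) (H : Group c₂ ℓ₂) →
        Decidable (Group._≈_ G) → Decidable (Group._≈_ H) → Decidable (Group._≈_ (G ×G H))
×-dec G H d e (a , b) (a' , b') with d a a' | e b b'
... | yes p | yes q = yes (p , q)
... | no ¬p | _     = no λ pq → ¬p (proj₁ pq)
... | yes _ | no ¬q = no λ pq → ¬q (proj₂ pq)

_×S_ : ∀ {a b} {X : Set a} {Y : Set b} {k l} → (Fin k → X) → (Fin l → Y) → Fin (k * l) → X × Y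
_×S_ {k = k} {l = l} A B x = A (proj₁ (remQuot {k} l x)) , B (proj₂ (remQuot {k} l x))

-- A difference (a , b) - (a' , b') equals (g , h) exactly when a - a' = g and b - b' = h,
-- so the multiplicity of (g , h) in Δ(A_i × B_i , A_j × B_j) is the product of the
-- multiplicities of g in Δ(A_i , A_j) and of h in Δ(B_i , B_j), that is λa λb.
-- Likewise the enumeration of a product set is injective (resp. surjective) whenever
-- both factor enumerations are, which gives the order na nb and the ka kb-subsets.
module Submission where

open import Defs
open import Level using (Level)
open import Data.Nat using (ℕ; zero; suc; _+_; _*_)
open import Data.Nat.Properties using (+-assoc; +-*-semiring)
open import Data.Fin using (Fin; zero; suc; combine; remQuot; _↑ˡ_; _↑ʳ_)
open import Data.Fin.Properties using (remQuot-combine; combine-remQuot)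
open import Data.Product using (∃; _×_; _,_; proj₁; proj₂; uncurry)
open import Data.Product.Relation.Binary.Pointwise.NonDependent using (Pointwise)
open import Data.Bool using (if_then_else_)
open import Data.Vec.Functional using (Vector)
open import Relation.Nullary using (Dec; yes; no; does)
open import Relation.Binary using (Rel; Decidable)
open import Relation.Binary.PropositionalEquality
open import Algebra.Bundles using (Group)
open import Algebra.Properties.Semiring.Sum +-*-semiring
  using (sum; sum-syntax; sum-cong-≗; *-distribˡ-sum; *-distribʳ-sum)

open ≡-Reasoning

sumFin≡sum : ∀ {n} (f : Vector ℕ n) → sumFin f ≡ sum f
sumFin≡sum {zero}  f = refl
sumFin≡sum {suc n} f = cong (f zero +_) (sumFin≡sum (λ i → f (suc i)))

sum-↑ : ∀ m n (f : Vector ℕ (m + n)) →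
        sum f ≡ sum (λ i → f (i ↑ˡ n)) + sum (λ j → f (m ↑ʳ j))
sum-↑ zero    n f = refl
sum-↑ (suc m) n f = trans (cong (f zero +_) (sum-↑ m n (λ i → f (suc i))))
                          (sym (+-assoc (f zero) _ _))

sum-combine : ∀ k l (f : Vector ℕ (k * l)) →
              sum f ≡ ∑[ i < k ] ∑[ j < l ] f (combine i j)
sum-combine zero    l f = refl
sum-combine (suc k) l f =
  trans (sum-↑ l (k * l) f)
        (cong (sum (λ j → f (j ↑ˡ (k * l))) +_) (sum-combine k l (λ x → f (l ↑ʳ x))))

∑∑-* : ∀ {k l} (f : Vector ℕ k) (g : Vector ℕ l) →
       ∑[ i < k ] ∑[ j < l ] (f i * g j) ≡ sum f * sum g
∑∑-* {k} {l} f g = begin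
  ∑[ i < k ] ∑[ j < l ] (f i * g j)  ≡⟨ sum-cong-≗ (λ i → sym (*-distribˡ-sum (f i) g)) ⟩
  ∑[ i < k ] (f i * sum g)           ≡⟨ sym (*-distribʳ-sum (sum g) f) ⟩
  sum f * sum g                      ∎

sum-remQuot-* : ∀ k l (f : Vector ℕ k) (g : Vector ℕ l) →
                ∑[ x < k * l ] (f (proj₁ (remQuot {k} l x)) * g (proj₂ (remQuot {k} l x)))
                  ≡ sum f * sum g
sum-remQuot-* k l f g = begin
  ∑[ x < k * l ] F (remQuot {k} l x)
    ≡⟨ sum-combine k l _ ⟩
  ∑[ i < k ] ∑[ j < l ] F (remQuot {k} l (combine i j))
    ≡⟨ sum-cong-≗ (λ i → sum-cong-≗ (λ j → cong F (remQuot-combine {k} {l} i j))) ⟩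
  ∑[ i < k ] ∑[ j < l ] (f i * g j)
    ≡⟨ ∑∑-* f g ⟩
  sum f * sum g
    ∎
  where
  F : Fin k × Fin l → ℕ
  F (i , j) = f i * g j

×S-combine : ∀ {a b} {X : Set a} {Y : Set b} {k l} (A : Fin k → X) (B : Fin l → Y) i j →
             (A ×S B) (combine i j) ≡ (A i , B j)
×S-combine {k = k} {l} A B i j =
  cong (λ p → A (proj₁ p) , B (proj₂ p)) (remQuot-combine {k} {l} i j)

module _ {a b ℓ₁ ℓ₂} {X : Set a} {Y : Set b} (_≈₁_ : Rel X ℓ₁) (_≈₂_ : Rel Y ℓ₂)
         {k l : ℕ} {A : Fin k → X} {B : Fin l → Y} where

  ×S-injective : (∀ i j → A i ≈₁ A j → i ≡ j) → (∀ i j → B i ≈₂ B j → i ≡ j) →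
                 ∀ x y → Pointwise _≈₁_ _≈₂_ ((A ×S B) x) ((A ×S B) y) → x ≡ y
  ×S-injective A-inj B-inj x y (Ax≈Ay , Bx≈By) = begin
    x                                  ≡⟨ combine-remQuot {k} l x ⟨
    uncurry combine (remQuot {k} l x)  ≡⟨ cong (uncurry combine) remQuot-x≡remQuot-y ⟩
    uncurry combine (remQuot {k} l y)  ≡⟨ combine-remQuot {k} l y ⟩
    y                                  ∎
    where
    remQuot-x≡remQuot-y : remQuot {k} l x ≡ remQuot {k} l y
    remQuot-x≡remQuot-y = cong₂ _,_ (A-inj _ _ Ax≈Ay) (B-inj _ _ Bx≈By)

  ×S-surjective : (∀ x → ∃ λ i → A i ≈₁ x) → (∀ y → ∃ λ j → B j ≈₂ y) →
                  ∀ p → ∃ λ z → Pointwise _≈₁_ _≈₂_ ((A ×S B) z) p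
  ×S-surjective A-surj B-surj (x , y) with A-surj x | B-surj y
  ... | i , Ai≈x | j , Bj≈y =
    combine i j ,
    subst (λ p → Pointwise _≈₁_ _≈₂_ p (x , y)) (sym (×S-combine A B i j)) (Ai≈x , Bj≈y)

𝟙 : ∀ {p} {P : Set p} → Dec P → ℕ
𝟙 P? = if does P? then 1 else 0

module _ {c ℓ} (G : Group c ℓ) (_≟_ : Decidable (Group._≈_ G)) where
  open Group G using (Carrier; _∙_; _⁻¹)

  multΔ≡∑∑ : ∀ {k l} (A : Fin k → Carrier) (B : Fin l → Carrier) g →
             multΔ G _≟_ A B g ≡ ∑[ x < k ] ∑[ y < l ] 𝟙 ((A x ∙ B y ⁻¹) ≟ g)
  multΔ≡∑∑ {k} {l} A B g =
    trans (sumFin≡sum (λ x → sumFin (δ x))) (sum-cong-≗ (λ x → sumFin≡sum (δ x)))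
    where
    δ : Fin k → Fin l → ℕ
    δ x y = 𝟙 ((A x ∙ B y ⁻¹) ≟ g)

module _ {c₁ ℓ₁ c₂ ℓ₂} (Ga : Group c₁ ℓ₁) (Gb : Group c₂ ℓ₂) where
  private
    module A = Group Ga
    module B = Group Gb
    module AB = Group (Ga ×G Gb)

  HasOrder-× : ∀ {na nb} → HasOrder Ga na → HasOrder Gb nb → HasOrder (Ga ×G Gb) (na * nb)
  HasOrder-× (fa , fa-inj , fa-surj) (fb , fb-inj , fb-surj) =
    fa ×S fb ,
    ×S-injective A._≈_ B._≈_ fa-inj fb-inj ,
    ×S-surjective A._≈_ B._≈_ fa-surj fb-surj

  IsKSubset-× : ∀ {ka kb} {X : Fin ka → A.Carrier} {Y : Fin kb → B.Carrier} →
                IsKSubset Ga X → IsKSubset Gb Y → IsKSubset (Ga ×G Gb) (X ×S Y)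
  IsKSubset-× = ×S-injective A._≈_ B._≈_

  module _ (da : Decidable A._≈_) (db : Decidable B._≈_) where

    𝟙-×-dec : ∀ p q → 𝟙 (×-dec Ga Gb da db p q)
                        ≡ 𝟙 (da (proj₁ p) (proj₁ q)) * 𝟙 (db (proj₂ p) (proj₂ q))
    𝟙-×-dec (a , b) (a' , b') with da a a' | db b b'
    ... | yes _ | yes _ = refl
    ... | yes _ | no _  = refl
    ... | no _  | yes _ = refl
    ... | no _  | no _  = refl

    multΔ-× : ∀ {ka kb} (X X' : Fin ka → A.Carrier) (Y Y' : Fin kb → B.Carrier) g h →
              multΔ (Ga ×G Gb) (×-dec Ga Gb da db) (X ×S Y) (X' ×S Y') (g , h)
                ≡ multΔ Ga da X X' g * multΔ Gb db Y Y' h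
    multΔ-× {ka} {kb} X X' Y Y' g h = begin
      multΔ (Ga ×G Gb) (×-dec Ga Gb da db) (X ×S Y) (X' ×S Y') (g , h)
        ≡⟨ multΔ≡∑∑ (Ga ×G Gb) (×-dec Ga Gb da db) (X ×S Y) (X' ×S Y') (g , h) ⟩
      ∑[ x < ka * kb ] ∑[ y < ka * kb ] 𝟙 (×-dec Ga Gb da db (diff x y) (g , h))
        ≡⟨ sum-cong-≗ (λ x → sum-cong-≗ (λ y → 𝟙-×-dec (diff x y) (g , h))) ⟩
      ∑[ x < ka * kb ] ∑[ y < ka * kb ] (δa (quot x) (quot y) * δb (rem x) (rem y))
        ≡⟨ sum-cong-≗ (λ x → sum-remQuot-* ka kb (δa (quot x)) (δb (rem x))) ⟩
      ∑[ x < ka * kb ] (sum (δa (quot x)) * sum (δb (rem x)))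
        ≡⟨ sum-remQuot-* ka kb (λ i → sum (δa i)) (λ j → sum (δb j)) ⟩
      (∑[ i < ka ] sum (δa i)) * (∑[ j < kb ] sum (δb j))
        ≡⟨ cong₂ _*_ (multΔ≡∑∑ Ga da X X' g) (multΔ≡∑∑ Gb db Y Y' h) ⟨
      multΔ Ga da X X' g * multΔ Gb db Y Y' h
        ∎
      where
      diff : Fin (ka * kb) → Fin (ka * kb) → AB.Carrier
      diff x y = (X ×S Y) x AB.∙ (X' ×S Y') y AB.⁻¹
      quot : Fin (ka * kb) → Fin ka
      quot x = proj₁ (remQuot {ka} kb x)
      rem : Fin (ka * kb) → Fin kb
      rem x = proj₂ (remQuot {ka} kb x)
      δa : Fin ka → Fin ka → ℕ
      δa i i' = 𝟙 (da (X i A.∙ X' i' A.⁻¹) g)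
      δb : Fin kb → Fin kb → ℕ
      δb j j' = 𝟙 (db (Y j B.∙ Y' j' B.⁻¹) h)

theorem5p1 : ∀ {c₁ ℓ₁ c₂ ℓ₂ : Level} (Ga : Group c₁ ℓ₁) (Gb : Group c₂ ℓ₂)
    (da : Decidable (Group._≈_ Ga)) (db : Decidable (Group._≈_ Gb))
    (na nb m ka kb λa λb : ℕ)
    (A : Fin m → Fin ka → Group.Carrier Ga) (B : Fin m → Fin kb → Group.Carrier Gb) →
    IsPSEDF Ga da na m ka λa A →
    IsPSEDF Gb db nb m kb λb B →
    IsPSEDF (Ga ×G Gb) (×-dec Ga Gb da db) (na * nb) m (ka * kb) (λa * λb)
      (λ i → A i ×S B i)
theorem5p1 Ga Gb da db na nb m ka kb λa λb A B
           (order-a , 1<m , A-sub , ΔA) (order-b , _ , B-sub , ΔB) =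
  HasOrder-× Ga Gb order-a order-b ,
  1<m ,
  (λ i → IsKSubset-× Ga Gb (A-sub i) (B-sub i)) ,
  λ { i j i≢j (g , h) → trans (multΔ-× Ga Gb da db (A i) (A j) (B i) (B j) g h)
                              (cong₂ _*_ (ΔA i j i≢j g) (ΔB i j i≢j h)) }
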